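{- Let $n\geq1$ and $d$ be integers with $|d|\geq2$. Then the elements $\epsilon_v$, $1\le v\le n-1$, of $\mathbb{Q}[x]/(x^n-1)$ are linearly independent over $\mathbb{Q}$, as are the elements $g_v$, $1\le v\le n-1$; and $\dim_{\mathbb{Q}}\mathcal E_{n,d}=n-1$ (dimension of the $\mathbb{Q}$-span).
   Context: In $\mathbb{Q}[x,x^{ -1}]/(x^n-1)$ (so $x^a$ depends only on $a\bmod n$) put $e_v=x^v-1$, $\epsilon_v=d\,e_v-e_{dv}$, and $g_v=d\,x^v(x-1)-x^{dv}(x^d-1)$ for $v\in\mathbb{Z}_n$. $\mathcal E_{n,d}$ denotes the $\mathbb{Z}$-span of $\epsilon_1,\dots,\epsilon_{n-1}$. -}

module Defs where

open import Data.Nat as ℕ using (ℕ; zero; suc; NonZero; _≡ᵇ_)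
open import Data.Integer as ℤ using (ℤ; +_; _%ℕ_)
open import Data.Rational as ℚ using (ℚ; 0ℚ; 1ℚ; _/_)
open import Data.Fin using (Fin; toℕ)
open import Data.Bool using (if_then_else_)
open import Data.List using (List; map; foldr; upTo)

-- The ring Q[x,x⁻¹]/(xⁿ - 1), represented by coefficient vectors:
-- an element is f : Fin n → ℚ, standing for Σ_{i<n} f i · xⁱ.
R : ℕ → Set
R n = Fin n → ℚ

module _ (n : ℕ) .{{_ : NonZero n}} where

  zeroR : R n
  zeroR _ = 0ℚ

  infixl 6 _⊕_ _⊖_
  infixl 7 _⊛_ _·_

  _⊕_ : R n → R n → R n
  (f ⊕ g) i = f i ℚ.+ g i

  _⊖_ : R n → R n → R n
  (f ⊖ g) i = f i ℚ.- g i

  _·_ : ℚ → R n → R n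
  (c · f) i = c ℚ.* f i

  sumFin : ∀ {m} → (Fin m → ℚ) → ℚ
  sumFin {zero} h = 0ℚ
  sumFin {suc m} h = h Fin.zero ℚ.+ sumFin (λ i → h (Fin.suc i))
    where import Data.Fin as Fin

  -- ring multiplication: cyclic convolution (xⁱ · xʲ = x^{(i+j) mod n})
  _⊛_ : R n → R n → R n
  (f ⊛ g) k = sumFin λ i → sumFin λ j →
    if ((toℕ i ℕ.+ toℕ j) ℕ.% n) ≡ᵇ toℕ k then f i ℚ.* g j else 0ℚ

  X^ : ℤ → R n
  X^ a i = if toℕ i ≡ᵇ (a %ℕ n) then 1ℚ else 0ℚ

  one : R n
  one = X^ (+ 0)

  e : ℤ → R n
  e v = X^ v ⊖ one

  ι : ℤ → ℚ
  ι z = z / 1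

  ε : (d : ℤ) → ℤ → R n
  ε d v = (ι d · e v) ⊖ e (d ℤ.* v)

  g : (d : ℤ) → ℤ → R n
  g d v = (ι d · (X^ v ⊛ (X^ (+ 1) ⊖ one))) ⊖ (X^ (d ℤ.* v) ⊛ (X^ d ⊖ one))

  linComb : (ℕ → ℚ) → (ℕ → R n) → R n
  linComb c f = foldr (λ v acc → (c v · f v) ⊕ acc) zeroR (map suc (upTo (n ℕ.∸ 1)))

  LinIndep : (ℕ → R n) → Set
  LinIndep f = ∀ (c : ℕ → ℚ) → linComb c f ≡ zeroR →
               ∀ v → 1 ℕ.≤ v → v ℕ.< n → c v ≡ 0ℚ
    where open import Relation.Binary.PropositionalEquality using (_≡_)

{-# OPTIONS --safe #-}
-- Away from the constant term, the coefficient of x^k in Σ_v c_v ε_v is d c_k − Σ_{dv ≡ k} c_v.  So a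
-- vanishing combination makes c an eigenvector, with eigenvalue d, of the push-forward of coefficients
-- along v ↦ dv mod n.  Push-forward does not increase the ℓ¹-norm, hence |d|·‖c‖₁ ≤ ‖c‖₁ and c = 0.
-- For the g_v: x^a (x^b − 1) = e_{a+b} − e_a gives g_v = ε_{v+1} − ε_v, and ε_n = 0, so summation by
-- parts turns Σ c_v g_v = 0 into a vanishing combination of the ε_v with coefficients c_{v−1} − c_v,
-- where c_0 = 0; hence every c_v equals c_0.
module Submission where

open import Algebra.Bundles using (CommutativeRing)
open import Data.Bool using (true; false; if_then_else_)
open import Data.Empty using (⊥-elim)
open import Data.Fin using (Fin; zero; suc; toℕ; fromℕ<)
open import Data.Fin.Properties using (toℕ<n; toℕ-fromℕ<; toℕ-inject₁; toℕ-fromℕ)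
open import Data.Integer as ℤ using (ℤ; +_; -[1+_]; _%ℕ_; _/ℕ_)
import Data.Integer.Properties as ℤ
open import Data.Integer.DivMod using (n%ℕd<d; a≡a%ℕn+[a/ℕn]*n)
import Data.Integer.Solver as ℤ-Solver
open import Data.List using (foldr; map; applyUpTo)
open import Data.Nat as ℕ using (ℕ; zero; suc; _≡ᵇ_; z≤n; s≤s; NonZero)
import Data.Nat.Properties as ℕ
import Data.Nat.DivMod as ℕ
open import Data.Nat.Coprimality using (1-coprimeTo) renaming (sym to coprime-sym)
open import Data.Product using (_×_; _,_)
open import Data.Rational
  using (ℚ; 0ℚ; 1ℚ; _+_; _*_; _-_; ∣_∣; _≤_; _<_; _/_; *≤*; *<*; positive; nonNegative)
open import Data.Rational.Properties
import Data.Rational.Solver as ℚ-Solver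
open import Data.Vec.Functional using (removeAt)
open import Function using (_∘_; id)
open import Relation.Binary.PropositionalEquality

open import Algebra.Properties.Semiring.Sum (CommutativeRing.semiring +-*-commutativeRing)
open import Algebra.Properties.Group +-0-group using () renaming (x∙y⁻¹≈ε⇒x≈y to p-q≡0⇒p≡q)
open import Algebra.Properties.Ring (CommutativeRing.ring +-*-commutativeRing) using ([y-z]x≈yx-zx)

open import Defs

δ : ℕ → ℕ → ℚ
δ a b = if a ≡ᵇ b then 1ℚ else 0ℚ

δ-sym : ∀ a b → δ a b ≡ δ b a
δ-sym zero    zero    = refl
δ-sym zero    (suc b) = refl
δ-sym (suc a) zero    = refl
δ-sym (suc a) (suc b) = δ-sym a b

0≤δ : ∀ a b → 0ℚ ≤ δ a b
0≤δ a b with a ≡ᵇ b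
... | true  = *≤* (ℤ.+≤+ z≤n)
... | false = ≤-refl

if-then-else-0 : ∀ b x → (if b then x else 0ℚ) ≡ x * (if b then 1ℚ else 0ℚ)
if-then-else-0 true  x = sym (*-identityʳ x)
if-then-else-0 false x = sym (*-zeroʳ x)

∑-distrib-- : ∀ {m} (f g : Fin m → ℚ) → ∑[ i < m ] (f i - g i) ≡ sum f - sum g
∑-distrib-- {zero}  f g = refl
∑-distrib-- {suc m} f g = trans (cong (_+_ (f zero - g zero)) (∑-distrib-- (f ∘ suc) (g ∘ suc)))
  (solve 4 (λ a b c d → a :- b :+ (c :- d) := a :+ c :- (b :+ d)) refl
     (f zero) (g zero) (sum (f ∘ suc)) (sum (g ∘ suc)))
  where open ℚ-Solver.+-*-Solver

∑-mono-≤ : ∀ {m} {f g : Fin m → ℚ} → (∀ i → f i ≤ g i) → sum f ≤ sum g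
∑-mono-≤ {zero}  _   = ≤-refl
∑-mono-≤ {suc m} {f} {g} f≤g = +-mono-≤ (f≤g zero) (∑-mono-≤ {f = f ∘ suc} {g ∘ suc} (f≤g ∘ suc))

∑-nonNeg : ∀ {m} {f : Fin m → ℚ} → (∀ i → 0ℚ ≤ f i) → 0ℚ ≤ sum f
∑-nonNeg {m} {f} 0≤f = subst (_≤ sum f) (sum-replicate-zero m) (∑-mono-≤ {f = λ _ → 0ℚ} {f} 0≤f)

term≤∑ : ∀ {m} {f : Fin m → ℚ} → (∀ i → 0ℚ ≤ f i) → ∀ i → f i ≤ sum f
term≤∑ {suc m} {f} 0≤f i = begin
  f i                      ≡⟨ +-identityʳ (f i) ⟨
  f i + 0ℚ                 ≤⟨ +-monoʳ-≤ (f i) (∑-nonNeg {f = removeAt f i} (λ _ → 0≤f _)) ⟩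
  f i + sum (removeAt f i) ≡⟨ sum-remove f ⟨
  sum f                    ∎
  where open ≤-Reasoning

∣∑∣≤∑∣∣ : ∀ {m} (f : Fin m → ℚ) → ∣ sum f ∣ ≤ ∑[ i < m ] ∣ f i ∣
∣∑∣≤∑∣∣ {zero}  f = ≤-refl
∣∑∣≤∑∣∣ {suc m} f =
  ≤-trans (∣p+q∣≤∣p∣+∣q∣ (f zero) _) (+-monoʳ-≤ ∣ f zero ∣ (∣∑∣≤∑∣∣ (f ∘ suc)))

∑-snoc : ∀ m (h : ℕ → ℚ) → ∑[ u < suc m ] h (toℕ u) ≡ ∑[ u < m ] h (toℕ u) + h m
∑-snoc m h = trans (sum-init-last {m} (h ∘ toℕ))
  (cong₂ _+_ (sum-cong-≗ {m} (cong h ∘ toℕ-inject₁)) (cong h (toℕ-fromℕ m)))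

∑-δ : ∀ {m} (h : ℕ → ℚ) {a} → a ℕ.< m → ∑[ u < m ] (δ (toℕ u) a * h (toℕ u)) ≡ h a
∑-δ {suc m} h {zero}  _ = begin
  1ℚ * h 0 + ∑[ u < m ] (0ℚ * h (suc (toℕ u)))
    ≡⟨ cong₂ _+_ (*-identityˡ (h 0)) (sym (*-distribˡ-sum 0ℚ (λ (u : Fin m) → h (suc (toℕ u))))) ⟩
  h 0 + 0ℚ * ∑[ u < m ] h (suc (toℕ u)) ≡⟨ cong (_+_ (h 0)) (*-zeroˡ (∑[ u < m ] h (suc (toℕ u)))) ⟩
  h 0 + 0ℚ                              ≡⟨ +-identityʳ (h 0) ⟩
  h 0                                   ∎
  where open ≡-Reasoning
∑-δ {suc m} h {suc a} (s≤s a<m) =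
  trans (cong₂ _+_ (*-zeroˡ (h 0)) (∑-δ (h ∘ suc) a<m)) (+-identityˡ (h (suc a)))

∑-δ≤1 : ∀ m a → ∑[ w < m ] δ (toℕ w) a ≤ 1ℚ
∑-δ≤1 zero    a       = *≤* (ℤ.+≤+ z≤n)
∑-δ≤1 (suc m) zero    = ≤-reflexive (trans (cong (_+_ 1ℚ) (sum-replicate-zero m)) (+-identityʳ 1ℚ))
∑-δ≤1 (suc m) (suc a) = subst (_≤ 1ℚ) (sym (+-identityˡ _)) (∑-δ≤1 m a)

∑-δ-suc≤1 : ∀ m a → ∑[ w < m ] δ (suc (toℕ w)) a ≤ 1ℚ
∑-δ-suc≤1 m a =
  ≤-trans (subst (_≤ δ 0 a + S) (+-identityˡ S) (+-monoˡ-≤ S (0≤δ 0 a))) (∑-δ≤1 (suc m) a)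
  where
  S : ℚ
  S = ∑[ w < m ] δ (suc (toℕ w)) a

delay : (ℕ → ℚ) → ℕ → ℚ
delay b zero    = 0ℚ
delay b (suc u) = b u

∑-by-parts : ∀ m (b E : ℕ → ℚ) →
  ∑[ u < m ] (b (toℕ u) * (E (suc (toℕ u)) - E (toℕ u))) ≡
  ∑[ u < m ] ((delay b (toℕ u) - b (toℕ u)) * E (toℕ u)) + delay b m * E m
∑-by-parts zero    b E = sym (trans (+-identityˡ _) (*-zeroˡ (E 0)))
∑-by-parts (suc m) b E = begin
  ∑[ u < suc m ] T (toℕ u)                  ≡⟨ ∑-snoc m T ⟩
  ∑[ u < m ] T (toℕ u) + T m                ≡⟨ cong (_+ T m) (∑-by-parts m b E) ⟩
  ∑[ u < m ] D (toℕ u) + delay b m * E m + T m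
    ≡⟨ solve 5 (λ S c b x y → S :+ c :* x :+ b :* (y :- x) := S :+ (c :- b) :* x :+ b :* y) refl
         (∑[ u < m ] D (toℕ u)) (delay b m) (b m) (E m) (E (suc m)) ⟩
  ∑[ u < m ] D (toℕ u) + D m + b m * E (suc m) ≡⟨ cong (_+ b m * E (suc m)) (∑-snoc m D) ⟨
  ∑[ u < suc m ] D (toℕ u) + b m * E (suc m) ∎
  where
  open ≡-Reasoning
  open ℚ-Solver.+-*-Solver
  T D : ℕ → ℚ
  T t = b t * (E (suc t) - E t)
  D t = (delay b t - b t) * E t

1<p⇒p*q≤q⇒q≤0 : ∀ {p q} → 1ℚ < p → p * q ≤ q → q ≤ 0ℚ
1<p⇒p*q≤q⇒q≤0 {p} {q} 1<p pq≤q = ≮⇒≥ λ 0<q → <-irrefl refl (<-≤-trans 1<p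
  (*-cancelʳ-≤-pos q {{positive 0<q}} (subst (p * q ≤_) (sym (*-identityˡ q)) pq≤q)))

module _ {m : ℕ} where

  push : (Fin m → ℕ) → (Fin m → ℚ) → ℕ → ℚ
  push σ C k = ∑[ u < m ] (C u * δ k (σ u))

  ∣push∣≤push∣∣ : ∀ σ C k → ∣ push σ C k ∣ ≤ push σ (∣_∣ ∘ C) k
  ∣push∣≤push∣∣ σ C k = ≤-trans (∣∑∣≤∑∣∣ (λ u → C u * δ k (σ u))) (≤-reflexive (sum-cong-≗ {m} λ u →
    trans (∣p*q∣≡∣p∣*∣q∣ (C u) (δ k (σ u))) (cong (∣ C u ∣ *_) (0≤p⇒∣p∣≡p (0≤δ k (σ u))))))

  ∑-push≤∑ : ∀ σ D → (∀ u → 0ℚ ≤ D u) → ∑[ w < m ] push σ D (suc (toℕ w)) ≤ sum D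
  ∑-push≤∑ σ D 0≤D = begin
    ∑[ w < m ] ∑[ u < m ] (D u * δ (suc (toℕ w)) (σ u))
      ≡⟨ ∑-comm (λ (w u : Fin m) → D u * δ (suc (toℕ w)) (σ u)) ⟩
    ∑[ u < m ] ∑[ w < m ] (D u * δ (suc (toℕ w)) (σ u))
      ≡⟨ sum-cong-≗ {m} (λ u → *-distribˡ-sum (D u) (λ (w : Fin m) → δ (suc (toℕ w)) (σ u))) ⟨
    ∑[ u < m ] (D u * ∑[ w < m ] δ (suc (toℕ w)) (σ u))
      ≤⟨ ∑-mono-≤ (λ u → *-monoˡ-≤-nonNeg (D u) {{nonNegative (0≤D u)}} (∑-δ-suc≤1 m (σ u))) ⟩
    ∑[ u < m ] (D u * 1ℚ)
      ≡⟨ sum-cong-≗ {m} (*-identityʳ ∘ D) ⟩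
    sum D ∎
    where open ≤-Reasoning

  push-eigenvector≡0 : ∀ q → 1ℚ < ∣ q ∣ → ∀ σ C →
    (∀ w → q * C w ≡ push σ C (suc (toℕ w))) → ∀ u → C u ≡ 0ℚ
  push-eigenvector≡0 q 1<∣q∣ σ C eigen u =
    ∣p∣≡0⇒p≡0 (C u) (≤-antisym (≤-trans (term≤∑ (0≤∣p∣ ∘ C) u) ∑∣C∣≤0) (0≤∣p∣ (C u)))
    where
    ∣q∣∑∣C∣≤∑∣C∣ : ∣ q ∣ * ∑[ w < m ] ∣ C w ∣ ≤ ∑[ w < m ] ∣ C w ∣
    ∣q∣∑∣C∣≤∑∣C∣ = begin
      ∣ q ∣ * ∑[ w < m ] ∣ C w ∣
        ≡⟨ *-distribˡ-sum ∣ q ∣ (∣_∣ ∘ C) ⟩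
      ∑[ w < m ] (∣ q ∣ * ∣ C w ∣)
        ≡⟨ sum-cong-≗ {m} (λ w → trans (sym (∣p*q∣≡∣p∣*∣q∣ q (C w))) (cong ∣_∣ (eigen w))) ⟩
      ∑[ w < m ] ∣ push σ C (suc (toℕ w)) ∣
        ≤⟨ ∑-mono-≤ (λ (w : Fin m) → ∣push∣≤push∣∣ σ C (suc (toℕ w))) ⟩
      ∑[ w < m ] push σ (∣_∣ ∘ C) (suc (toℕ w))
        ≤⟨ ∑-push≤∑ σ (∣_∣ ∘ C) (0≤∣p∣ ∘ C) ⟩
      ∑[ w < m ] ∣ C w ∣ ∎
      where open ≤-Reasoning
    ∑∣C∣≤0 : ∑[ w < m ] ∣ C w ∣ ≤ 0ℚ
    ∑∣C∣≤0 = 1<p⇒p*q≤q⇒q≤0 1<∣q∣ ∣q∣∑∣C∣≤∑∣C∣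

∣r⊖s∣≡k*n⇒r≡s : ∀ {n r s} k → r ℕ.< n → s ℕ.< n → ℤ.∣ r ℤ.⊖ s ∣ ≡ k ℕ.* n → r ≡ s
∣r⊖s∣≡k*n⇒r≡s {r = r} {s} zero _ _ ∣r⊖s∣≡0 =
  ℤ.+-injective (ℤ.i-j≡0⇒i≡j (+ r) (+ s) (trans (ℤ.m-n≡m⊖n r s) (ℤ.∣i∣≡0⇒i≡0 ∣r⊖s∣≡0)))
∣r⊖s∣≡k*n⇒r≡s {n} {r} {s} (suc k) r<n s<n ∣r⊖s∣≡n+k*n = ⊥-elim (ℕ.<-irrefl refl (begin-strict
  n                 ≤⟨ ℕ.m≤m+n n (k ℕ.* n) ⟩
  n ℕ.+ k ℕ.* n     ≡⟨ ∣r⊖s∣≡n+k*n ⟨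
  ℤ.∣ r ℤ.⊖ s ∣     ≤⟨ ℤ.∣m⊝n∣≤m⊔n r s ⟩
  r ℕ.⊔ s           <⟨ ℕ.⊔-lub r<n s<n ⟩
  n                 ∎))
  where open ℕ.≤-Reasoning

%ℕ-unique : ∀ {n} .{{_ : NonZero n}} {r} i q → r ℕ.< n → i ≡ + r ℤ.+ q ℤ.* + n → i %ℕ n ≡ r
%ℕ-unique {n} {r} i q r<n i≡r+qn =
  sym (∣r⊖s∣≡k*n⇒r≡s ℤ.∣ q′ ℤ.- q ∣ r<n (n%ℕd<d i n)
    (trans (cong ℤ.∣_∣ r⊖s≡) (ℤ.abs-* (q′ ℤ.- q) (+ n))))
  where
  open ℤ-Solver.+-*-Solver
  open ≡-Reasoning
  s = i %ℕ n
  q′ = i /ℕ n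
  r⊖s≡ : r ℤ.⊖ s ≡ (q′ ℤ.- q) ℤ.* + n
  r⊖s≡ = begin
    r ℤ.⊖ s                              ≡⟨ ℤ.m-n≡m⊖n r s ⟨
    + r ℤ.- + s
      ≡⟨ solve 5 (λ R S Q Q′ N → R :- S := (R :+ Q :* N) :- (S :+ Q′ :* N) :+ (Q′ :- Q) :* N) refl
           (+ r) (+ s) q q′ (+ n) ⟩
    (+ r ℤ.+ q ℤ.* + n) ℤ.- (+ s ℤ.+ q′ ℤ.* + n) ℤ.+ (q′ ℤ.- q) ℤ.* + n
      ≡⟨ cong₂ (λ x y → x ℤ.- y ℤ.+ (q′ ℤ.- q) ℤ.* + n) i≡r+qn (a≡a%ℕn+[a/ℕn]*n i n) ⟨
    i ℤ.- i ℤ.+ (q′ ℤ.- q) ℤ.* + n       ≡⟨ cong (ℤ._+ (q′ ℤ.- q) ℤ.* + n) (ℤ.+-inverseʳ i) ⟩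
    ℤ.0ℤ ℤ.+ (q′ ℤ.- q) ℤ.* + n          ≡⟨ ℤ.+-identityˡ _ ⟩
    (q′ ℤ.- q) ℤ.* + n                   ∎

%ℕ-distrib-+ : ∀ n .{{_ : NonZero n}} i j → (i ℤ.+ j) %ℕ n ≡ (i %ℕ n ℕ.+ j %ℕ n) ℕ.% n
%ℕ-distrib-+ n i j = %ℕ-unique (i ℤ.+ j) (qᵢ ℤ.+ qⱼ ℤ.+ + t) (ℕ.m%n<n s n) (begin
  i ℤ.+ j
    ≡⟨ cong₂ ℤ._+_ (a≡a%ℕn+[a/ℕn]*n i n) (a≡a%ℕn+[a/ℕn]*n j n) ⟩
  (+ (i %ℕ n) ℤ.+ qᵢ ℤ.* + n) ℤ.+ (+ (j %ℕ n) ℤ.+ qⱼ ℤ.* + n)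
    ≡⟨ solve 5 (λ A B Qᵢ Qⱼ N → (A :+ Qᵢ :* N) :+ (B :+ Qⱼ :* N) := (A :+ B) :+ (Qᵢ :+ Qⱼ) :* N) refl
         (+ (i %ℕ n)) (+ (j %ℕ n)) qᵢ qⱼ (+ n) ⟩
  + s ℤ.+ (qᵢ ℤ.+ qⱼ) ℤ.* + n
    ≡⟨ cong (ℤ._+ (qᵢ ℤ.+ qⱼ) ℤ.* + n) +s≡ ⟩
  (+ (s ℕ.% n) ℤ.+ + t ℤ.* + n) ℤ.+ (qᵢ ℤ.+ qⱼ) ℤ.* + n
    ≡⟨ solve 5 (λ R T Qᵢ Qⱼ N → (R :+ T :* N) :+ (Qᵢ :+ Qⱼ) :* N := R :+ (Qᵢ :+ Qⱼ :+ T) :* N) refl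
         (+ (s ℕ.% n)) (+ t) qᵢ qⱼ (+ n) ⟩
  + (s ℕ.% n) ℤ.+ (qᵢ ℤ.+ qⱼ ℤ.+ + t) ℤ.* + n ∎)
  where
  open ℤ-Solver.+-*-Solver
  open ≡-Reasoning
  qᵢ = i /ℕ n
  qⱼ = j /ℕ n
  s = i %ℕ n ℕ.+ j %ℕ n
  t = s ℕ./ n
  +s≡ : + s ≡ + (s ℕ.% n) ℤ.+ + t ℤ.* + n
  +s≡ = trans (cong +_ (ℕ.m≡m%n+[m/n]*n s n))
              (trans (ℤ.pos-+ (s ℕ.% n) (t ℕ.* n)) (cong (ℤ._+_ (+ (s ℕ.% n))) (ℤ.pos-* t n)))

[i*n]%ℕn≡0 : ∀ n .{{_ : NonZero n}} i → (i ℤ.* + n) %ℕ n ≡ 0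
[i*n]%ℕn≡0 n i = %ℕ-unique (i ℤ.* + n) i (ℕ.>-nonZero⁻¹ n) (sym (ℤ.+-identityˡ _))

1<∣i/1∣ : ∀ i → 1 ℕ.< ℤ.∣ i ∣ → 1ℚ < ∣ i / 1 ∣
1<∣i/1∣ (+ k) 1<k = subst (1ℚ <_) (cong ∣_∣ (sym (normalize-coprime (coprime-sym (1-coprimeTo k)))))
  (*<* (subst (+ 1 ℤ.<_) (sym (ℤ.*-identityʳ (+ k))) (ℤ.+<+ 1<k)))
1<∣i/1∣ -[1+ k ] 1<k = subst (1ℚ <_) (sym (∣-p∣≡∣p∣ (+ suc k / 1))) (1<∣i/1∣ (+ suc k) 1<k)

module _ (n : ℕ) .{{_ : NonZero n}} where

  sumFin≡sum : ∀ {k} (h : Fin k → ℚ) → sumFin n h ≡ sum h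
  sumFin≡sum {zero}  h = refl
  sumFin≡sum {suc k} h = cong (_+_ (h zero)) (sumFin≡sum (h ∘ suc))

  ⊛≡∑∑ : ∀ f g k → _⊛_ n f g k ≡
    ∑[ i < n ] ∑[ j < n ] (if ((toℕ i ℕ.+ toℕ j) ℕ.% n) ≡ᵇ toℕ k then f i * g j else 0ℚ)
  ⊛≡∑∑ f g k = trans (sumFin≡sum (λ i → sumFin n (T i))) (sum-cong-≗ {n} (λ i → sumFin≡sum (T i)))
    where
    T : Fin n → Fin n → ℚ
    T i j = if ((toℕ i ℕ.+ toℕ j) ℕ.% n) ≡ᵇ toℕ k then f i * g j else 0ℚ

  X^⊛ : ∀ a F k → _⊛_ n (X^ n a) F k ≡ ∑[ j < n ] (F j * δ ((a %ℕ n ℕ.+ toℕ j) ℕ.% n) (toℕ k))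
  X^⊛ a F k = begin
    _⊛_ n (X^ n a) F k
      ≡⟨ ⊛≡∑∑ (X^ n a) F k ⟩
    ∑[ i < n ] ∑[ j < n ] (if ((toℕ i ℕ.+ toℕ j) ℕ.% n) ≡ᵇ toℕ k then δ (toℕ i) a′ * F j else 0ℚ)
      ≡⟨ sum-cong-≗ {n} (λ i → sum-cong-≗ {n} (summand i)) ⟩
    ∑[ i < n ] ∑[ j < n ] (δ (toℕ i) a′ * (F j * Δ (toℕ i) j))
      ≡⟨ sum-cong-≗ {n} (λ i → *-distribˡ-sum (δ (toℕ i) a′) (λ j → F j * Δ (toℕ i) j)) ⟨
    ∑[ i < n ] (δ (toℕ i) a′ * ∑[ j < n ] (F j * Δ (toℕ i) j))
      ≡⟨ ∑-δ (λ t → ∑[ j < n ] (F j * Δ t j)) (n%ℕd<d a n) ⟩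
    ∑[ j < n ] (F j * Δ a′ j) ∎
    where
    open ≡-Reasoning
    a′ = a %ℕ n
    Δ : ℕ → Fin n → ℚ
    Δ t j = δ ((t ℕ.+ toℕ j) ℕ.% n) (toℕ k)
    summand : ∀ (i j : Fin n) →
      (if ((toℕ i ℕ.+ toℕ j) ℕ.% n) ≡ᵇ toℕ k then δ (toℕ i) a′ * F j else 0ℚ) ≡
      δ (toℕ i) a′ * (F j * Δ (toℕ i) j)
    summand i j = trans (if-then-else-0 (((toℕ i ℕ.+ toℕ j) ℕ.% n) ≡ᵇ toℕ k) (δ (toℕ i) a′ * F j))
                        (*-assoc (δ (toℕ i) a′) (F j) (Δ (toℕ i) j))

  X^⊛e : ∀ a b k → _⊛_ n (X^ n a) (e n b) k ≡ e n (b ℤ.+ a) k - e n a k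
  X^⊛e a b k = begin
    _⊛_ n (X^ n a) (e n b) k
      ≡⟨ X^⊛ a (e n b) k ⟩
    ∑[ j < n ] ((δ (toℕ j) b′ - δ (toℕ j) 0′) * h (toℕ j))
      ≡⟨ sum-cong-≗ {n} (λ j → [y-z]x≈yx-zx (h (toℕ j)) (δ (toℕ j) b′) (δ (toℕ j) 0′)) ⟩
    ∑[ j < n ] (δ (toℕ j) b′ * h (toℕ j) - δ (toℕ j) 0′ * h (toℕ j))
      ≡⟨ ∑-distrib-- (λ (j : Fin n) → δ (toℕ j) b′ * h (toℕ j)) (λ j → δ (toℕ j) 0′ * h (toℕ j)) ⟩
    ∑[ j < n ] (δ (toℕ j) b′ * h (toℕ j)) - ∑[ j < n ] (δ (toℕ j) 0′ * h (toℕ j))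
      ≡⟨ cong₂ _-_ (∑-δ h (n%ℕd<d b n)) (∑-δ h (n%ℕd<d (+ 0) n)) ⟩
    h b′ - h 0′
      ≡⟨ cong₂ _-_ (trans (δ-sym _ (toℕ k)) (cong (δ (toℕ k)) x^a·x^b))
                   (trans (δ-sym _ (toℕ k)) (cong (δ (toℕ k)) x^a·1)) ⟩
    X^ n (b ℤ.+ a) k - X^ n a k
      ≡⟨ solve 3 (λ x y z → x :- y := (x :- z) :- (y :- z)) refl
           (X^ n (b ℤ.+ a) k) (X^ n a k) (one n k) ⟩
    e n (b ℤ.+ a) k - e n a k ∎
    where
    open ≡-Reasoning
    open ℚ-Solver.+-*-Solver
    a′ = a %ℕ n
    b′ = b %ℕ n
    0′ : ℕ
    0′ = + 0 %ℕ n
    h : ℕ → ℚ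
    h t = δ ((a′ ℕ.+ t) ℕ.% n) (toℕ k)
    x^a·x^b : (a′ ℕ.+ b′) ℕ.% n ≡ (b ℤ.+ a) %ℕ n
    x^a·x^b = trans (cong (ℕ._% n) (ℕ.+-comm a′ b′)) (sym (%ℕ-distrib-+ n b a))
    x^a·1 : (a′ ℕ.+ 0′) ℕ.% n ≡ a′
    x^a·1 = trans (sym (%ℕ-distrib-+ n a (+ 0))) (cong (_%ℕ n) (ℤ.+-identityʳ a))

  g≡Δε : ∀ d v k → g n d (+ v) k ≡ ε n d (+ suc v) k - ε n d (+ v) k
  g≡Δε d v k = begin
    g n d (+ v) k
      ≡⟨ cong₂ (λ x y → ι n d * x - y) (X^⊛e (+ v) (+ 1) k) (X^⊛e (d ℤ.* + v) d k) ⟩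
    ι n d * (E (+ suc v) - E (+ v)) - (E (d ℤ.+ d ℤ.* + v) - E (d ℤ.* + v))
      ≡⟨ cong (λ z → ι n d * (E (+ suc v) - E (+ v)) - (E z - E (d ℤ.* + v))) d+dv≡d[1+v] ⟩
    ι n d * (E (+ suc v) - E (+ v)) - (E (d ℤ.* + suc v) - E (d ℤ.* + v))
      ≡⟨ solve 5 (λ q a b c c′ → q :* (a :- b) :- (c :- c′) := (q :* a :- c) :- (q :* b :- c′)) refl
           (ι n d) (E (+ suc v)) (E (+ v)) (E (d ℤ.* + suc v)) (E (d ℤ.* + v)) ⟩
    ε n d (+ suc v) k - ε n d (+ v) k ∎
    where
    open ≡-Reasoning
    open ℚ-Solver.+-*-Solver
    E : ℤ → ℚ
    E a = e n a k
    d+dv≡d[1+v] : d ℤ.+ d ℤ.* + v ≡ d ℤ.* + suc v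
    d+dv≡d[1+v] =
      sym (trans (ℤ.*-distribˡ-+ d (+ 1) (+ v)) (cong (ℤ._+ d ℤ.* + v) (ℤ.*-identityʳ d)))

  a%n≡0⇒e≡0 : ∀ a k → a %ℕ n ≡ 0 → e n a k ≡ 0ℚ
  a%n≡0⇒e≡0 a k a%n≡0 = trans (cong (λ r → δ (toℕ k) r - one n k) a%n≡0%n) (+-inverseʳ (one n k))
    where
    a%n≡0%n : a %ℕ n ≡ 0 ℕ.% n
    a%n≡0%n = trans a%n≡0 (sym (ℕ.m<n⇒m%n≡m (ℕ.>-nonZero⁻¹ n)))

  εₙ≡0 : ∀ d k → ε n d (+ n) k ≡ 0ℚ
  εₙ≡0 d k = begin
    ι n d * e n (+ n) k - e n (d ℤ.* + n) k
      ≡⟨ cong₂ (λ x y → ι n d * x - y) (a%n≡0⇒e≡0 (+ n) k (ℕ.n%n≡0 n))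
                                       (a%n≡0⇒e≡0 (d ℤ.* + n) k ([i*n]%ℕn≡0 n d)) ⟩
    ι n d * 0ℚ - 0ℚ ≡⟨ cong (_- 0ℚ) (*-zeroʳ (ι n d)) ⟩
    0ℚ ∎
    where open ≡-Reasoning

module _ (m : ℕ) where

  private
    n : ℕ
    n = suc m

  -- Linear independence of F 0, …, F (m ∸ 1), with the combination required to vanish pointwise:
  -- lacking function extensionality, only this form transports along pointwise identities such as g≡Δε.
  Independent : (ℕ → R n) → Set
  Independent F = ∀ (c : ℕ → ℚ) → (∀ k → ∑[ u < m ] (c (toℕ u) * F (toℕ u) k) ≡ 0ℚ) →
                  ∀ u → u ℕ.< m → c u ≡ 0ℚ

  linComb≡∑ : ∀ c f k → linComb n c f k ≡ ∑[ u < m ] (c (suc (toℕ u)) * f (suc (toℕ u)) k)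
  linComb≡∑ c f k = go id m
    where
    go : ∀ (h : ℕ → ℕ) j →
      foldr (λ v acc → _⊕_ n (_·_ n (c v) (f v)) acc) (zeroR n) (map suc (applyUpTo h j)) k ≡
      ∑[ u < j ] (c (suc (h (toℕ u))) * f (suc (h (toℕ u))) k)
    go h zero    = refl
    go h (suc j) = cong (_+_ (c (suc (h 0)) * f (suc (h 0)) k)) (go (h ∘ suc) j)

  Independent⇒LinIndep : ∀ f → Independent (f ∘ suc) → LinIndep n f
  Independent⇒LinIndep f indep c lc≡0 (suc u) _ (s≤s u<m) =
    indep (c ∘ suc) (λ k → trans (sym (linComb≡∑ c f k)) (cong-app lc≡0 k)) u u<m

  Independent-Δ : ∀ E F → (∀ k → E m k ≡ 0ℚ) → (∀ u k → F u k ≡ E (suc u) k - E u k) →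
                  Independent E → Independent F
  Independent-Δ E F Eₘ≡0 F≡ΔE indep-E c ∑cF≡0 = c≡0
    where
    ∑Δc·E : Fin n → ℚ
    ∑Δc·E k = ∑[ u < m ] ((delay c (toℕ u) - c (toℕ u)) * E (toℕ u) k)
    ∑Δc·E≡0 : ∀ k → ∑Δc·E k ≡ 0ℚ
    ∑Δc·E≡0 k = begin
      ∑Δc·E k                     ≡⟨ +-identityʳ (∑Δc·E k) ⟨
      ∑Δc·E k + 0ℚ                ≡⟨ cong (_+_ (∑Δc·E k)) (trans (cong (delay c m *_) (Eₘ≡0 k))
                                                                 (*-zeroʳ (delay c m))) ⟨
      ∑Δc·E k + delay c m * E m k ≡⟨ ∑-by-parts m c (λ u → E u k) ⟨
      ∑[ u < m ] (c (toℕ u) * (E (suc (toℕ u)) k - E (toℕ u) k))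
        ≡⟨ sum-cong-≗ {m} (λ u → cong (c (toℕ u) *_) (F≡ΔE (toℕ u) k)) ⟨
      ∑[ u < m ] (c (toℕ u) * F (toℕ u) k)
        ≡⟨ ∑cF≡0 k ⟩
      0ℚ ∎
      where open ≡-Reasoning
    c≡delay-c : ∀ u → u ℕ.< m → c u ≡ delay c u
    c≡delay-c u u<m = sym (p-q≡0⇒p≡q _ _ (indep-E (λ u → delay c u - c u) ∑Δc·E≡0 u u<m))
    c≡0 : ∀ u → u ℕ.< m → c u ≡ 0ℚ
    c≡0 zero    0<m   = c≡delay-c 0 0<m
    c≡0 (suc u) 1+u<m = trans (c≡delay-c (suc u) 1+u<m) (c≡0 u (ℕ.<⇒≤ 1+u<m))

  ε-at-suc : ∀ d v w → v ℕ.< n →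
    ε n d (+ v) (suc w) ≡ ι n d * δ (suc (toℕ w)) v - δ (suc (toℕ w)) ((d ℤ.* + v) %ℕ n)
  ε-at-suc d v w v<n = cong₂ (λ x y → ι n d * x - y)
    (trans (+-identityʳ _) (cong (δ (suc (toℕ w))) (ℕ.m<n⇒m%n≡m v<n))) (+-identityʳ _)

  ε-independent : ∀ d → 1ℚ < ∣ ι n d ∣ → Independent (λ u → ε n d (+ suc u))
  ε-independent d 1<∣d∣ c ∑cε≡0 u u<m = subst (λ t → c t ≡ 0ℚ) (toℕ-fromℕ< u<m)
    (push-eigenvector≡0 (ι n d) 1<∣d∣ σ C eigen (fromℕ< u<m))
    where
    C : Fin m → ℚ
    C = c ∘ toℕ
    σ : Fin m → ℕ
    σ u = (d ℤ.* + suc (toℕ u)) %ℕ n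
    summand : ∀ w u → ι n d * (δ (toℕ u) (toℕ w) * C u) - C u * δ (suc (toℕ w)) (σ u) ≡
                   C u * ε n d (+ suc (toℕ u)) (suc w)
    summand w u = begin
      ι n d * (δ (toℕ u) (toℕ w) * C u) - C u * δ (suc (toℕ w)) (σ u)
        ≡⟨ cong (λ x → ι n d * (x * C u) - C u * δ (suc (toℕ w)) (σ u)) (δ-sym (toℕ u) (toℕ w)) ⟩
      ι n d * (δ (toℕ w) (toℕ u) * C u) - C u * δ (suc (toℕ w)) (σ u)
        ≡⟨ solve 4 (λ q x c y → q :* (x :* c) :- c :* y := c :* (q :* x :- y)) refl
             (ι n d) (δ (toℕ w) (toℕ u)) (C u) (δ (suc (toℕ w)) (σ u)) ⟩
      C u * (ι n d * δ (toℕ w) (toℕ u) - δ (suc (toℕ w)) (σ u))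
        ≡⟨ cong (C u *_) (ε-at-suc d (suc (toℕ u)) w (s≤s (toℕ<n u))) ⟨
      C u * ε n d (+ suc (toℕ u)) (suc w) ∎
      where
      open ≡-Reasoning
      open ℚ-Solver.+-*-Solver
    eigen : ∀ w → ι n d * C w ≡ push σ C (suc (toℕ w))
    eigen w = p-q≡0⇒p≡q _ _ (begin
      ι n d * C w - push σ C (suc (toℕ w))
        ≡⟨ cong (λ x → ι n d * x - push σ C (suc (toℕ w))) (∑-δ c (toℕ<n w)) ⟨
      ι n d * ∑[ u < m ] (δ (toℕ u) (toℕ w) * C u) - push σ C (suc (toℕ w))
        ≡⟨ cong (_- push σ C (suc (toℕ w)))
                (*-distribˡ-sum (ι n d) (λ u → δ (toℕ u) (toℕ w) * C u)) ⟩
      ∑[ u < m ] (ι n d * (δ (toℕ u) (toℕ w) * C u)) - push σ C (suc (toℕ w))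
        ≡⟨ ∑-distrib-- (λ u → ι n d * (δ (toℕ u) (toℕ w) * C u))
                       (λ u → C u * δ (suc (toℕ w)) (σ u)) ⟨
      ∑[ u < m ] (ι n d * (δ (toℕ u) (toℕ w) * C u) - C u * δ (suc (toℕ w)) (σ u))
        ≡⟨ sum-cong-≗ {m} (summand w) ⟩
      ∑[ u < m ] (C u * ε n d (+ suc (toℕ u)) (suc w))
        ≡⟨ ∑cε≡0 (suc w) ⟩
      0ℚ ∎)
      where open ≡-Reasoning

  g-independent : ∀ d → 1ℚ < ∣ ι n d ∣ → Independent (λ u → g n d (+ suc u))
  g-independent d 1<∣d∣ = Independent-Δ (λ u → ε n d (+ suc u)) (λ u → g n d (+ suc u))
    (εₙ≡0 n d) (λ u → g≡Δε n d (suc u)) (ε-independent d 1<∣d∣)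

theorem2p3 : (n : ℕ) .{{_ : NonZero n}} (d : ℤ) → 2 ℕ.≤ ℤ.∣ d ∣ →
    LinIndep n (λ v → ε n d (+ v)) × LinIndep n (λ v → g n d (+ v))
theorem2p3 zero    d _       = (λ _ _ _ _ ()) , (λ _ _ _ _ ())
theorem2p3 (suc m) d 2≤∣d∣ =
    Independent⇒LinIndep m _ (ε-independent m d 1<∣d∣)
  , Independent⇒LinIndep m _ (g-independent m d 1<∣d∣)
  where
  1<∣d∣ : 1ℚ < ∣ ι (suc m) d ∣
  1<∣d∣ = 1<∣i/1∣ d 2≤∣d∣
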